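{- For every integer $a\geq 1$, each of the sets $B_a=\{x\in\mathbb{N}_0: t(x+a)=1-t(x)\}$ and $C_a=\{x\in\mathbb{N}_0: t(x+a)=t(x)\}$ can be obtained from the two sets $B_1$ and $C_1$ by a finite number of applications of the operations of translation $E_h$ ($h\in\mathbb{Z}$), union and intersection.
   Context: $\mathbb{N}_0=\{0,1,2,\dots\}$. $t(n)$ is the Thue–Morse sequence: $t(n)=0$ if the binary expansion of $n$ has an even number of $1$'s, $t(n)=1$ otherwise. For $a\ge1$, $B_a$ and $C_a$ are the solution sets in $\mathbb{N}_0$ of $t(x+a)=1-t(x)$ and $t(x+a)=t(x)$ respectively; in particular $B_1=\{x: t(x+1)=1-t(x)\}$, $C_1=\{x:t(x+1)=t(x)\}$. For a set of integers $A$ and $h\in\mathbb{Z}$, the translation operator is $E_h(A)=\{y-h: y\in A\}$. -}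

module Defs where

open import Data.Nat using (ℕ; zero; suc; _+_; _∸_; _%_; _/_)
open import Data.Integer using (ℤ; +_) renaming (_+_ to _+ℤ_)
open import Data.Product using (Σ; _×_)
open import Data.Sum using (_⊎_)
open import Relation.Binary.PropositionalEquality using (_≡_)

-- Number of 1's in the binary expansion of m, computed with fuel f.
-- With fuel f ≥ m the result is exact (each step halves m; 0 has no 1's).
popcountFuel : ℕ → ℕ → ℕ
popcountFuel zero    m = 0
popcountFuel (suc f) m = m % 2 + popcountFuel f (m / 2)

popcount : ℕ → ℕ
popcount n = popcountFuel n n

t : ℕ → ℕ
t n = popcount n % 2

-- B_a and C_a as subsets of ℤ (they lie in ℕ₀ ⊆ ℤ)
B : ℕ → ℤ → Set
B a z = Σ ℕ λ x → (z ≡ + x) × (t (x + a) ≡ 1 ∸ t x)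

C : ℕ → ℤ → Set
C a z = Σ ℕ λ x → (z ≡ + x) × (t (x + a) ≡ t x)

data Expr : Set where
  `B₁ : Expr
  `C₁ : Expr
  `E  : ℤ → Expr → Expr
  _∪_ : Expr → Expr → Expr
  _∩_ : Expr → Expr → Expr

-- the set of integers denoted by an expression; E_h(A) = {y - h : y ∈ A},
-- i.e. z ∈ E_h(A) ⇔ z + h ∈ A
⟦_⟧ : Expr → ℤ → Set
⟦ `B₁ ⟧    z = B 1 z
⟦ `C₁ ⟧    z = C 1 z
⟦ `E h e ⟧ z = ⟦ e ⟧ (z +ℤ h)
⟦ e ∪ f ⟧  z = ⟦ e ⟧ z ⊎ ⟦ f ⟧ z
⟦ e ∩ f ⟧  z = ⟦ e ⟧ z × ⟦ f ⟧ z

module Submission where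

-- For a bit d write flip d u for u (d = false) or 1 ∸ u
-- (d = true), and let Differ d a be the set of x ∈ ℕ₀ with
-- t(x + a) = flip d (t x); thus B_a = Differ true a and C_a = Differ false a
-- hold by definition.  Since all values of t are bits, passing from x to
-- x + a + b goes through x + a: the change of t over distance a + b is the
-- xor of its changes over a and over b.  As sets this reads
--   Differ d (a + b) = ⋃_{e ∈ Bool} Differ e a ∩ E_a (Differ (e xor d) b),
-- and with a = 1 it yields
--   B_{n+2} = (C₁ ∩ E₁ B_{n+1}) ∪ (B₁ ∩ E₁ C_{n+1}),
--   C_{n+2} = (C₁ ∩ E₁ C_{n+1}) ∪ (B₁ ∩ E₁ B_{n+1}).

open import Defs
open import Data.Bool using (Bool; true; false; _xor_)
open import Data.Nat using (ℕ; _≤_; zero; suc; _+_; _∸_; z≤n; s≤s)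
open import Data.Nat.Properties using (+-assoc; ≤-pred)
open import Data.Nat.DivMod using (m%n<n)
open import Data.Integer using (ℤ; +_) renaming (_+_ to _+ℤ_)
open import Data.Integer.Properties using (+-injective)
open import Data.Product using (Σ; _×_; _,_)
open import Data.Sum using (_⊎_; inj₁; inj₂)
open import Data.Product.Function.NonDependent.Propositional using (_×-⇔_)
open import Data.Sum.Function.Propositional using (_⊎-⇔_)
open import Function using (id)
open import Function.Bundles using (_⇔_; mk⇔)
import Function.Properties.Equivalence as ⇔
open import Relation.Binary.PropositionalEquality
  using (_≡_; refl; sym; cong; module ≡-Reasoning)

flip : Bool → ℕ → ℕ
flip false u = u
flip true  u = 1 ∸ u

flip-between : ∀ {u v} → u ≤ 1 → v ≤ 1 → Σ Bool λ e → v ≡ flip e u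
flip-between z≤n       z≤n       = false , refl
flip-between z≤n       (s≤s z≤n) = true  , refl
flip-between (s≤s z≤n) z≤n       = true  , refl
flip-between (s≤s z≤n) (s≤s z≤n) = false , refl

-- Flips compose by xor (on bits; 1 ∸ (1 ∸ u) ≡ u fails for u ≥ 2).
flip-relay : ∀ {u} e d → u ≤ 1 → flip d u ≡ flip (e xor d) (flip e u)
flip-relay false false z≤n       = refl
flip-relay false true  z≤n       = refl
flip-relay true  false z≤n       = refl
flip-relay true  true  z≤n       = refl
flip-relay false false (s≤s z≤n) = refl
flip-relay false true  (s≤s z≤n) = refl
flip-relay true  false (s≤s z≤n) = refl
flip-relay true  true  (s≤s z≤n) = refl

t-bit : ∀ n → t n ≤ 1
t-bit n = ≤-pred (m%n<n (popcount n) 2)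

Differ : Bool → ℕ → ℤ → Set
Differ d a z = Σ ℕ λ x → (z ≡ + x) × (t (x + a) ≡ flip d (t x))

Differ-split : ∀ d a b z →
  Differ d (a + b) z ⇔ Σ Bool λ e → Differ e a z × Differ (e xor d) b (z +ℤ + a)
Differ-split d a b z = mk⇔ split join
  where
  open ≡-Reasoning

  split : Differ d (a + b) z →
          Σ Bool λ e → Differ e a z × Differ (e xor d) b (z +ℤ + a)
  split (x , refl , tx) with flip-between (t-bit x) (t-bit (x + a))
  ... | e , step = e , (x , refl , step) , (x + a , refl , relay)
    where
    relay : t (x + a + b) ≡ flip (e xor d) (t (x + a))
    relay = begin
      t (x + a + b)                    ≡⟨ cong t (+-assoc x a b) ⟩
      t (x + (a + b))                  ≡⟨ tx ⟩
      flip d (t x)                     ≡⟨ flip-relay e d (t-bit x) ⟩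
      flip (e xor d) (flip e (t x))    ≡⟨ cong (flip (e xor d)) step ⟨
      flip (e xor d) (t (x + a))       ∎

  join : (Σ Bool λ e → Differ e a z × Differ (e xor d) b (z +ℤ + a)) →
         Differ d (a + b) z
  join (e , (x , refl , step) , (y , x+a≡y , relay)) with +-injective x+a≡y
  ... | refl = x , refl , (begin
      t (x + (a + b))                  ≡⟨ cong t (+-assoc x a b) ⟨
      t (x + a + b)                    ≡⟨ relay ⟩
      flip (e xor d) (t (x + a))       ≡⟨ cong (flip (e xor d)) step ⟩
      flip (e xor d) (flip e (t x))    ≡⟨ flip-relay e d (t-bit x) ⟨
      flip d (t x)                     ∎)

Σ-Bool⇔⊎ : (P : Bool → Set) → (Σ Bool P) ⇔ (P false ⊎ P true)
Σ-Bool⇔⊎ P = mk⇔ to from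
  where
  to : Σ Bool P → P false ⊎ P true
  to (false , p) = inj₁ p
  to (true  , p) = inj₂ p

  from : P false ⊎ P true → Σ Bool P
  from (inj₁ p) = false , p
  from (inj₂ p) = true  , p

base : Bool → Expr
base false = `C₁
base true  = `B₁

base-correct : ∀ d z → ⟦ base d ⟧ z ⇔ Differ d 1 z
base-correct false z = mk⇔ id id
base-correct true  z = mk⇔ id id

express : Bool → ℕ → Expr
express d zero    = base d
express d (suc n) = (base false ∩ `E (+ 1) (express (false xor d) n))
                  ∪ (base true  ∩ `E (+ 1) (express (true  xor d) n))

express-correct : ∀ d n z → ⟦ express d n ⟧ z ⇔ Differ d (suc n) z
express-correct d zero    z = base-correct d z
express-correct d (suc n) z =
  ⇔.trans (peel false ⊎-⇔ peel true)
    (⇔.trans (⇔.sym (Σ-Bool⇔⊎ λ e → Differ e 1 z × Differ (e xor d) (suc n) (z +ℤ + 1)))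
             (⇔.sym (Differ-split d 1 (suc n) z)))
  where
  peel : ∀ e → (⟦ base e ⟧ z × ⟦ express (e xor d) n ⟧ (z +ℤ + 1))
             ⇔ (Differ e 1 z × Differ (e xor d) (suc n) (z +ℤ + 1))
  peel e = base-correct e z ×-⇔ express-correct (e xor d) n (z +ℤ + 1)

theorem1 : (a : ℕ) → 1 ≤ a →
    (Σ Expr λ e → (z : ℤ) → ⟦ e ⟧ z ⇔ B a z) × (Σ Expr λ e → (z : ℤ) → ⟦ e ⟧ z ⇔ C a z)
theorem1 (suc n) _ = (express true n , express-correct true n)
                   , (express false n , express-correct false n)
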